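{- Let $f:A\to B$ be a graph morphism. Then $f$ is an epimorphism in the category $\mathbf{Grphs}$ if and only if $f$ is a surjective function $P(A)\to P(B)$ on part sets, and $f$ is a monomorphism in $\mathbf{Grphs}$ if and only if $f$ is an injective function $P(A)\to P(B)$. Likewise, a strict graph morphism $f:A\to B$ is an epimorphism in $\mathbf{StGrphs}$ if and only if it is surjective on part sets, and is a monomorphism in $\mathbf{StGrphs}$ if and only if it is injective on part sets.
   Context: A graph $G$ consists of a vertex set $V(G)$, an edge set $E(G)$ disjoint from it, and an incidence function $\psi_G$ assigning to each edge an unordered pair $\{x,y\}$ of (not necessarily distinct) vertices; multiple edges and loops are allowed. The part set of $G$ is $P(G)=E(G)\cup V(G)$, and for a vertex $v$ we set $\psi_G(v)=\{v,v\}$. A graph morphism $f:G\to H$ is a function $f:P(G)\to P(H)$ with $f(V(G))\subseteq V(H)$ that preserves incidence: $\psi_H(f(e))=\{f(x),f(y)\}$ whenever $\psi_G(e)=\{x,y\}$, for all $e\in P(G)$ (so an edge may be sent to a vertex provided incidence is preserved). A strict graph morphism is a graph morphism sending edges to edges. $\mathbf{Grphs}$ is the category of all graphs with graph morphisms; $\mathbf{StGrphs}$ is the category of all graphs with strict graph morphisms; composition is composition of functions. -}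

module Defs where

open import Data.Product using (Σ; ∃; _×_; _,_; proj₁; proj₂)
open import Data.Sum using (_⊎_; inj₁; inj₂)
open import Relation.Binary.PropositionalEquality
  using (_≡_; refl; sym; trans; cong)

-- A graph: vertex set V, edge set E, and incidence function assigning to
-- each edge its (unordered) pair of ends, represented by an ordered pair
-- that is only ever compared up to swapping (see _≈ᵤ_).
record Graph : Set₁ where
  field
    V    : Set
    E    : Set
    ends : E → V × V
open Graph public

_≈ᵤ_ : {X : Set} → X × X → X × X → Set
(a , b) ≈ᵤ (c , d) = (a ≡ c × b ≡ d) ⊎ (a ≡ d × b ≡ c)

Parts : Graph → Set
Parts G = E G ⊎ V G

ψ : (G : Graph) → Parts G → V G × V G
ψ G (inj₁ e) = ends G e
ψ G (inj₂ v) = (v , v)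

mapPair : {X Y : Set} → (X → Y) → X × X → Y × Y
mapPair g (a , b) = (g a , g b)

record Hom (G H : Graph) : Set where
  field
    fP    : Parts G → Parts H
    fV    : V G → V H
    fP-V  : ∀ v → fP (inj₂ v) ≡ inj₂ (fV v)
    inc   : ∀ p → ψ H (fP p) ≈ᵤ mapPair fV (ψ G p)
open Hom public

≈ᵤ-map : {X Y : Set} (g : X → Y) {p q : X × X} →
         p ≈ᵤ q → mapPair g p ≈ᵤ mapPair g q
≈ᵤ-map g {a , b} {c , d} (inj₁ (x , y)) = inj₁ (cong g x , cong g y)
≈ᵤ-map g {a , b} {c , d} (inj₂ (x , y)) = inj₂ (cong g x , cong g y)

≈ᵤ-trans : {X : Set} {p q r : X × X} → p ≈ᵤ q → q ≈ᵤ r → p ≈ᵤ r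
≈ᵤ-trans {p = a , b} {c , d} {e , f} (inj₁ (x , y)) (inj₁ (z , w)) = inj₁ (trans x z , trans y w)
≈ᵤ-trans {p = a , b} {c , d} {e , f} (inj₁ (x , y)) (inj₂ (z , w)) = inj₂ (trans x z , trans y w)
≈ᵤ-trans {p = a , b} {c , d} {e , f} (inj₂ (x , y)) (inj₁ (z , w)) = inj₂ (trans x w , trans y z)
≈ᵤ-trans {p = a , b} {c , d} {e , f} (inj₂ (x , y)) (inj₂ (z , w)) = inj₁ (trans x w , trans y z)

_∘ᴳ_ : {A B C : Graph} → Hom B C → Hom A B → Hom A C
_∘ᴳ_ {A} {B} {C} g f = record
  { fP   = λ p → fP g (fP f p)
  ; fV   = λ v → fV g (fV f v)
  ; fP-V = λ v → trans (cong (fP g) (fP-V f v)) (fP-V g (fV f v))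
  ; inc  = λ p → ≈ᵤ-trans (inc g (fP f p)) (lemma p)
  }
  where
  lemma : ∀ p → mapPair (fV g) (ψ B (fP f p)) ≈ᵤ mapPair (λ v → fV g (fV f v)) (ψ A p)
  lemma p with ψ A p | inc f p
  ... | (a , b) | q = ≈ᵤ-map (fV g) q

IsStrict : {G H : Graph} → Hom G H → Set
IsStrict {G} {H} f = ∀ (e : E G) → ∃ λ (e' : E H) → fP f (inj₁ e) ≡ inj₁ e'

record StHom (G H : Graph) : Set where
  field
    hom    : Hom G H
    strict : IsStrict hom
open StHom public

_∘ˢ_ : {A B C : Graph} → StHom B C → StHom A B → StHom A C
g ∘ˢ f = record
  { hom    = hom g ∘ᴳ hom f
  ; strict = λ e → proj₁ (strict g (proj₁ (strict f e))) ,
                   trans (cong (fP (hom g)) (proj₂ (strict f e)))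
                         (proj₂ (strict g (proj₁ (strict f e))))
  }

_≗ᴴ_ : {G H : Graph} → Hom G H → Hom G H → Set
f ≗ᴴ g = ∀ p → fP f p ≡ fP g p

IsEpi : {A B : Graph} → Hom A B → Set₁
IsEpi {A} {B} f = ∀ (C : Graph) (g h : Hom B C) → (g ∘ᴳ f) ≗ᴴ (h ∘ᴳ f) → g ≗ᴴ h

IsMono : {A B : Graph} → Hom A B → Set₁
IsMono {A} {B} f = ∀ (C : Graph) (g h : Hom C A) → (f ∘ᴳ g) ≗ᴴ (f ∘ᴳ h) → g ≗ᴴ h

IsEpiSt : {A B : Graph} → StHom A B → Set₁
IsEpiSt {A} {B} f = ∀ (C : Graph) (g h : StHom B C) →
  hom (g ∘ˢ f) ≗ᴴ hom (h ∘ˢ f) → hom g ≗ᴴ hom h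

IsMonoSt : {A B : Graph} → StHom A B → Set₁
IsMonoSt {A} {B} f = ∀ (C : Graph) (g h : StHom C A) →
  hom (f ∘ˢ g) ≗ᴴ hom (f ∘ˢ h) → hom g ≗ᴴ hom h

Surj : {X Y : Set} → (X → Y) → Set
Surj {X} {Y} f = ∀ (y : Y) → ∃ λ (x : X) → f x ≡ y

Inj : {X Y : Set} → (X → Y) → Set
Inj {X} f = ∀ {x x' : X} → f x ≡ f x' → x ≡ x'

-- A morphism that is not surjective is distinguished from another one by
-- the classifier graph: mapping every part of B to "true", versus labelling
-- each part by whether it lies in the image of f (excluded middle decides
-- this), gives two strict morphisms that agree after f.  Edges carry the
-- labels of their ends, so the image, being closed under taking ends, is
-- labelled consistently.  A morphism that is not injective is detected by
-- the single-edge graph: every part x of A is the image of its edge under a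
-- morphism sending the two ends to those of x, and two parts with the same
-- image under f give two such morphisms agreeing after f, up to swapping
-- the ends.  In the strict category, vertices are detected by the one-vertex
-- graph instead, and an edge is never identified with a vertex.
module Submission where

open import Defs
open import Data.Bool using (Bool; true; false)
open import Data.Bool.Properties using (T-≡)
open import Data.Empty using (⊥)
open import Data.Product using (Σ; _×_; _,_; proj₁; proj₂)
open import Data.Sum using (inj₁; inj₂)
open import Data.Sum.Properties using (inj₁-injective; inj₂-injective)
open import Data.Unit using (⊤; tt)
open import Function.Bundles using (_⇔_; mk⇔; Equivalence)
open import Level using (0ℓ)
open import Axiom.ExcludedMiddle using (ExcludedMiddle)
open import Relation.Nullary using (Dec)
open import Relation.Nullary.Decidable using (isYes; fromWitness; toWitness)
open import Relation.Binary.PropositionalEquality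
  using (_≡_; _≢_; refl; sym; trans; cong; cong₂; subst)

≈ᵤ-sym : {X : Set} {p q : X × X} → p ≈ᵤ q → q ≈ᵤ p
≈ᵤ-sym {p = a , b} {c , d} (inj₁ (x , y)) = inj₁ (sym x , sym y)
≈ᵤ-sym {p = a , b} {c , d} (inj₂ (x , y)) = inj₂ (sym y , sym x)

isYes-true : {P : Set} (d : Dec P) → P → isYes d ≡ true
isYes-true d p = Equivalence.to T-≡ (fromWitness p)

isYes-true⁻¹ : {P : Set} (d : Dec P) → isYes d ≡ true → P
isYes-true⁻¹ d eq = toWitness (Equivalence.from T-≡ eq)

surjective⇒right-cancellable : {A B C : Graph} (f : Hom A B) → Surj (fP f) →
  (g h : Hom B C) → (g ∘ᴳ f) ≗ᴴ (h ∘ᴳ f) → g ≗ᴴ h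
surjective⇒right-cancellable f surj g h g∘f≗h∘f p with surj p
... | x , refl = g∘f≗h∘f x

injective⇒left-cancellable : {A B C : Graph} (f : Hom A B) → Inj (fP f) →
  (g h : Hom C A) → (f ∘ᴳ g) ≗ᴴ (f ∘ᴳ h) → g ≗ᴴ h
injective⇒left-cancellable f inj g h f∘g≗f∘h p = inj (f∘g≗f∘h p)

Classifier : Graph
Classifier = record
  { V = Bool ; E = Bool × Bool × Bool ; ends = λ (a , b , _) → (a , b) }

labelling : (A : Graph) → (V A → Bool) → (E A → Bool) → StHom A Classifier
labelling A vl el = record
  { hom = record { fP = fp ; fV = vl ; fP-V = λ _ → refl ; inc = incidence }
  ; strict = λ _ → _ , refl }
  where
  fp : Parts A → Parts Classifier
  fp (inj₁ e) = inj₁ (vl (proj₁ (ends A e)) , vl (proj₂ (ends A e)) , el e)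
  fp (inj₂ v) = inj₂ (vl v)
  incidence : ∀ p → ψ Classifier (fp p) ≈ᵤ mapPair vl (ψ A p)
  incidence (inj₁ e) = inj₁ (refl , refl)
  incidence (inj₂ v) = inj₁ (refl , refl)

Image : {A B : Graph} → Hom A B → Parts B → Set
Image {A} f p = Σ (Parts A) λ x → fP f x ≡ p

vertex∈Image : {A B : Graph} (f : Hom A B) (v : V A) → Image f (inj₂ (fV f v))
vertex∈Image f v = inj₂ v , fP-V f v

ends∈Image : {A B : Graph} (f : Hom A B) (e : E B) → Image f (inj₁ e) →
  Image f (inj₂ (proj₁ (ends B e))) × Image f (inj₂ (proj₂ (ends B e)))
ends∈Image f e (inj₂ w , fw≡e) with trans (sym (fP-V f w)) fw≡e
... | ()
ends∈Image {A} {B} f e (inj₁ d , fd≡e) =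
  from-incidence (subst (λ q → ψ B q ≈ᵤ mapPair (fV f) (ends A d)) fd≡e (inc f (inj₁ d)))
  where
  image-of : ∀ {u} v → u ≡ fV f v → Image f (inj₂ u)
  image-of v refl = vertex∈Image f v
  from-incidence : ends B e ≈ᵤ mapPair (fV f) (ends A d) →
    Image f (inj₂ (proj₁ (ends B e))) × Image f (inj₂ (proj₂ (ends B e)))
  from-incidence (inj₁ (s , t)) = image-of _ s , image-of _ t
  from-incidence (inj₂ (s , t)) = image-of _ s , image-of _ t

module _ (lem : ExcludedMiddle 0ℓ) {A B : Graph} (f : Hom A B) where

  indicator : StHom B Classifier
  indicator = labelling B (λ v → isYes (lem {Image f (inj₂ v)}))
                          (λ e → isYes (lem {Image f (inj₁ e)}))

  everywhereTrue : StHom B Classifier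
  everywhereTrue = labelling B (λ _ → true) (λ _ → true)

  everywhereTrue≡indicator-on-Image : ∀ p → Image f p → fP (hom everywhereTrue) p ≡ fP (hom indicator) p
  everywhereTrue≡indicator-on-Image (inj₂ v) v∈f = cong inj₂ (sym (isYes-true lem v∈f))
  everywhereTrue≡indicator-on-Image (inj₁ e) e∈f with ends∈Image f e e∈f
  ... | s∈f , t∈f = cong inj₁ (cong₂ _,_ (sym (isYes-true lem s∈f))
                      (cong₂ _,_ (sym (isYes-true lem t∈f)) (sym (isYes-true lem e∈f))))

  everywhereTrue≡indicator⇒Image : ∀ p → fP (hom everywhereTrue) p ≡ fP (hom indicator) p → Image f p
  everywhereTrue≡indicator⇒Image (inj₂ v) eq = isYes-true⁻¹ lem (sym (inj₂-injective eq))
  everywhereTrue≡indicator⇒Image (inj₁ e) eq =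
    isYes-true⁻¹ lem (sym (cong (λ (_ , _ , l) → l) (inj₁-injective eq)))

  strictly-right-cancellable⇒surjective :
    ((g h : StHom B Classifier) → (hom g ∘ᴳ f) ≗ᴴ (hom h ∘ᴳ f) → hom g ≗ᴴ hom h) →
    Surj (fP f)
  strictly-right-cancellable⇒surjective cancel p =
    everywhereTrue≡indicator⇒Image p
      (cancel everywhereTrue indicator (λ x → everywhereTrue≡indicator-on-Image (fP f x) (x , refl)) p)

Link : Graph
Link = record { V = Bool ; E = ⊤ ; ends = λ _ → (false , true) }

linkTo : (A : Graph) (x : Parts A) {a b : V A} → ψ A x ≈ᵤ (a , b) → Hom Link A
linkTo A x {a} {b} x≈ab = record { fP = fp ; fV = fv ; fP-V = λ _ → refl ; inc = incidence }
  where
  fv : Bool → V A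
  fv false = a
  fv true  = b
  fp : Parts Link → Parts A
  fp (inj₁ _) = x
  fp (inj₂ v) = inj₂ (fv v)
  incidence : ∀ p → ψ A (fp p) ≈ᵤ mapPair fv (ψ Link p)
  incidence (inj₁ _) = x≈ab
  incidence (inj₂ v) = inj₁ (refl , refl)

pointAt : (A : Graph) → Parts A → Hom Link A
pointAt A x = linkTo A x (inj₁ (refl , refl))

link-strict : {A : Graph} (h : Hom Link A) {e : E A} → fP h (inj₁ tt) ≡ inj₁ e → IsStrict h
link-strict h {e} he _ = e , he

collision⇒pointings : {A B : Graph} (f : Hom A B) (x x' : Parts A) → fP f x ≡ fP f x' →
  Σ (Hom Link A) λ h → fP h (inj₁ tt) ≡ x' × ((f ∘ᴳ pointAt A x) ≗ᴴ (f ∘ᴳ h))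
collision⇒pointings {A} {B} f x x' fx≡fx' =
  from-ends (≈ᵤ-trans (≈ᵤ-sym (subst (λ q → ψ B q ≈ᵤ mapPair (fV f) (ψ A x)) fx≡fx' (inc f x)))
                      (inc f x'))
  where
  a = proj₁ (ψ A x)
  b = proj₂ (ψ A x)
  a' = proj₁ (ψ A x')
  b' = proj₂ (ψ A x')
  vertices : ∀ {u u'} → fV f u ≡ fV f u' → fP f (inj₂ u) ≡ fP f (inj₂ u')
  vertices {u} {u'} eq = trans (fP-V f u) (trans (cong inj₂ eq) (sym (fP-V f u')))
  from-ends : mapPair (fV f) (a , b) ≈ᵤ mapPair (fV f) (a' , b') →
    Σ (Hom Link A) λ h → fP h (inj₁ tt) ≡ x' × ((f ∘ᴳ pointAt A x) ≗ᴴ (f ∘ᴳ h))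
  from-ends (inj₁ (aa' , bb')) = pointAt A x' , refl , agree
    where
    agree : (f ∘ᴳ pointAt A x) ≗ᴴ (f ∘ᴳ pointAt A x')
    agree (inj₁ _)     = fx≡fx'
    agree (inj₂ false) = vertices aa'
    agree (inj₂ true)  = vertices bb'
  from-ends (inj₂ (ab' , ba')) = linkTo A x' (inj₂ (refl , refl)) , refl , agree
    where
    agree : (f ∘ᴳ pointAt A x) ≗ᴴ (f ∘ᴳ linkTo A x' (inj₂ (refl , refl)))
    agree (inj₁ _)     = fx≡fx'
    agree (inj₂ false) = vertices ab'
    agree (inj₂ true)  = vertices ba'

Point : Graph
Point = record { V = ⊤ ; E = ⊥ ; ends = λ () }

vertexAt : (A : Graph) → V A → StHom Point A
vertexAt A v = record
  { hom = record { fP = fp ; fV = λ _ → v ; fP-V = λ _ → refl ; inc = incidence }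
  ; strict = λ () }
  where
  fp : Parts Point → Parts A
  fp (inj₂ _) = inj₂ v
  incidence : ∀ p → ψ A (fp p) ≈ᵤ mapPair (λ _ → v) (ψ Point p)
  incidence (inj₂ _) = inj₁ (refl , refl)

strict-edge≢vertex : {A B : Graph} (f : StHom A B) (e : E A) (v : V A) →
  fP (hom f) (inj₁ e) ≢ fP (hom f) (inj₂ v)
strict-edge≢vertex f e v fe≡fv with strict f e
... | e' , fe≡e' with trans (sym fe≡e') (trans fe≡fv (fP-V (hom f) v))
... | ()

epi⇔surjective : ExcludedMiddle 0ℓ → {A B : Graph} (f : Hom A B) → IsEpi f ⇔ Surj (fP f)
epi⇔surjective lem f = mk⇔
  (λ epi → strictly-right-cancellable⇒surjective lem f (λ g h → epi Classifier (hom g) (hom h)))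
  (λ surj C → surjective⇒right-cancellable f surj)

mono⇔injective : {A B : Graph} (f : Hom A B) → IsMono f ⇔ Inj (fP f)
mono⇔injective {A} f = mk⇔ mono⇒injective (λ inj C → injective⇒left-cancellable f inj)
  where
  mono⇒injective : IsMono f → Inj (fP f)
  mono⇒injective mono {x} {x'} fx≡fx' with collision⇒pointings f x x' fx≡fx'
  ... | h , hx' , agree = trans (mono Link (pointAt A x) h agree (inj₁ tt)) hx'

epiSt⇔surjective : ExcludedMiddle 0ℓ → {A B : Graph} (f : StHom A B) →
  IsEpiSt f ⇔ Surj (fP (hom f))
epiSt⇔surjective lem f = mk⇔
  (λ epi → strictly-right-cancellable⇒surjective lem (hom f) (epi Classifier))
  (λ surj C g h → surjective⇒right-cancellable (hom f) surj (hom g) (hom h))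

monoSt⇔injective : {A B : Graph} (f : StHom A B) → IsMonoSt f ⇔ Inj (fP (hom f))
monoSt⇔injective {A} f = mk⇔ mono⇒injective
  (λ inj C g h → injective⇒left-cancellable (hom f) inj (hom g) (hom h))
  where
  mono⇒injective : IsMonoSt f → Inj (fP (hom f))
  mono⇒injective mono {inj₂ v} {inj₂ v'} fv≡fv' =
    mono Point (vertexAt A v) (vertexAt A v') (λ { (inj₂ _) → fv≡fv' }) (inj₂ tt)
  mono⇒injective mono {inj₁ e} {inj₂ v'} fe≡fv' with () ← strict-edge≢vertex f e v' fe≡fv'
  mono⇒injective mono {inj₂ v} {inj₁ e'} fv≡fe' with () ← strict-edge≢vertex f e' v (sym fv≡fe')
  mono⇒injective mono {inj₁ e} {inj₁ e'} fe≡fe'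
    with collision⇒pointings (hom f) (inj₁ e) (inj₁ e') fe≡fe'
  ... | h , he' , agree =
    trans (mono Link (record { hom = pointAt A (inj₁ e) ; strict = link-strict (pointAt A (inj₁ e)) refl })
                     (record { hom = h ; strict = link-strict h he' }) agree (inj₁ tt))
          he'

mainTheorem1 : ExcludedMiddle 0ℓ →
    (∀ {A B : Graph} (f : Hom A B) →
    (IsEpi f ⇔ Surj (fP f)) × (IsMono f ⇔ Inj (fP f)))
    × (∀ {A B : Graph} (f : StHom A B) →
    (IsEpiSt f ⇔ Surj (fP (hom f))) × (IsMonoSt f ⇔ Inj (fP (hom f))))
mainTheorem1 lem =
  (λ f → epi⇔surjective lem f , mono⇔injective f) ,
  (λ f → epiSt⇔surjective lem f , monoSt⇔injective f)
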